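{- Let $A$ and $B$ be nonempty subsets of $[n]$ with $|A|+|B|\leq n$. Let $A'=A\setminus A^{\mathrm t}$ and $B'=B\setminus B^{\mathrm t}$. Then $(A,B)$ is maximal if and only if $A'$ is the partner of $B'$.
   Context: Lexicographic order: for finite sets $A,B$ of positive integers, $A\prec B$ if either $A\supseteq B$ or $\min(A\setminus B)<\min(B\setminus A)$ (so $A\prec A$). For a $k$-subset $R$ of $[n]$, $\mathcal{L}(R,k)=\{F\in\binom{[n]}{k}:F\prec R\}$. For $F\subseteq[n]$, $\ell(F)=\max\{x:[n-x+1,n]\subseteq F\}$ if $n\in F$ and $\ell(F)=0$ otherwise; $F^{\mathrm t}=[n-\ell(F)+1,n]$ (empty if $\ell(F)=0$). Two sets $F,H\subseteq[n]$ are partners of each other if there is $q$ with $F\cap H=\{q\}$ and $F\cup H=[q]$. Families $\mathcal{F}\subseteq\binom{[n]}{f}$, $\mathcal{G}\subseteq\binom{[n]}{g}$ are cross-intersecting if $F\cap G\ne\emptyset$ for all $F\in\mathcal{F},G\in\mathcal{G}$; a cross-intersecting pair $(\mathcal{F},\mathcal{G})$ is maximal if whenever $\mathcal{F}'\subseteq\binom{[n]}{f}$, $\mathcal{G}'\subseteq\binom{[n]}{g}$ are cross-intersecting with $\mathcal{F}\subseteq\mathcal{F}'$, $\mathcal{G}\subseteq\mathcal{G}'$, then $\mathcal{F}=\mathcal{F}'$ and $\mathcal{G}=\mathcal{G}'$. For sets $F,G\subseteq[n]$, $(F,G)$ is called maximal if $\mathcal{L}(F,|F|)$ and $\mathcal{L}(G,|G|)$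 are cross-intersecting and form a maximal pair. -}

module Defs where

open import Data.Nat using (ℕ; zero; suc; _∸_; _≤ᵇ_; _≡ᵇ_)
open import Data.Bool using (Bool; true; false; _∧_; if_then_else_)
open import Data.Fin using (Fin; toℕ; _<_; _≤_)
open import Data.Fin.Subset using (Subset; _∈_; _∉_; _⊆_; _∩_; _∪_; ⁅_⁆; ∣_∣; Nonempty)
open import Data.Vec using (Vec; []; _∷_; tabulate)
open import Data.Product using (Σ; ∃; _×_)
open import Data.Sum using (_⊎_)
open import Relation.Binary.PropositionalEquality using (_≡_)

-- Convention: a subset of [n] is a Subset n; index i : Fin n stands for the integer toℕ i + 1.

-- Lexicographic order A ≺ B : A ⊇ B, or min(A∖B) < min(B∖A).
-- The second alternative (given B∖A ≠ ∅ is handled by the first) is written as: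
-- some i ∈ A∖B such that no j < i lies in B∖A.
_≺_ : ∀ {n} → Subset n → Subset n → Set
_≺_ {n} A B = (B ⊆ A) ⊎ (Σ (Fin n) λ i → i ∈ A × i ∉ B × (∀ (j : Fin n) → j < i → j ∈ B → j ∈ A))

Family : ℕ → Set₁
Family n = Subset n → Set

𝓛 : ∀ {n} → Subset n → ℕ → Family n
𝓛 R k F = (∣ F ∣ ≡ k) × (F ≺ R)

-- ℓ(F): length of the longest terminal segment [n-x+1,n] contained in F
ℓ : ∀ {n} → Subset n → ℕ
ℓ [] = 0
ℓ {suc n} (b ∷ v) = if (b ∧ (ℓ v ≡ᵇ n)) then suc n else ℓ v

-- Fᵗ = [n-ℓ(F)+1, n]; index i (integer i+1) is in it iff n - ℓ(F) ≤ i
_ᵗ : ∀ {n} → Subset n → Subset n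
_ᵗ {n} F = tabulate (λ i → (n ∸ ℓ F) ≤ᵇ toℕ i)

upto : ∀ {n} → Fin n → Subset n
upto q = tabulate (λ j → toℕ j ≤ᵇ toℕ q)

Partner : ∀ {n} → Subset n → Subset n → Set
Partner {n} F H = Σ (Fin n) λ q → ((F ∩ H) ≡ ⁅ q ⁆) × ((F ∪ H) ≡ upto q)

_⊑_ : ∀ {n} → Family n → Family n → Set
𝓕 ⊑ 𝓖 = ∀ X → 𝓕 X → 𝓖 X

Uniform : ∀ {n} → ℕ → Family n → Set
Uniform f 𝓕 = ∀ X → 𝓕 X → ∣ X ∣ ≡ f

CrossIntersecting : ∀ {n} → Family n → Family n → Set
CrossIntersecting 𝓕 𝓖 = ∀ F G → 𝓕 F → 𝓖 G → Nonempty (F ∩ G)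

MaximalPair : ∀ {n} → ℕ → ℕ → Family n → Family n → Set₁
MaximalPair {n} f g 𝓕 𝓖 =
  CrossIntersecting 𝓕 𝓖 ×
  (∀ (𝓕' 𝓖' : Family n) → Uniform f 𝓕' → Uniform g 𝓖' →
     CrossIntersecting 𝓕' 𝓖' → 𝓕 ⊑ 𝓕' → 𝓖 ⊑ 𝓖' →
     (𝓕' ⊑ 𝓕) × (𝓖' ⊑ 𝓖))

Maximal : ∀ {n} → Subset n → Subset n → Set₁
Maximal F G = MaximalPair ∣ F ∣ ∣ G ∣ (𝓛 F ∣ F ∣) (𝓛 G ∣ G ∣)

-- Induct on n, splitting A and B at the point 1. If 1 ∈ A ∖ B, every member of 𝓛(A) contains 1
-- and every set through 1 lies in 𝓛(B), so (A,B) is maximal iff its restriction to [2,n] is, and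
-- partners on [2,n] correspond to partners on [n] with q shifted by one. If 1 ∈ A ∩ B, both
-- families consist of sets through 1, so maximality says exactly that A ∖ {1} and B ∖ {1} are
-- lexicographically last among sets of their sizes, i.e. terminal segments: A' = B' = {1}.
-- If 1 ∉ A ∪ B, the size bound leaves room for a member of 𝓛(B) through 1 avoiding A, while
-- A' ∪ B' misses 1 and cannot be an initial segment [q]. Throughout, maximality of a pair of
-- uniform families is used in the saturated form: every set of the right size meeting all of
-- one family belongs to the other.
module Submission where

open import Defs
open import Data.Nat using (ℕ; _+_; _≤_)
open import Data.Fin.Subset using (Subset; Nonempty; ∣_∣; _─_)
open import Data.Product using (_×_)
open import Function.Bundles using (_⇔_)

open import Data.Bool using (Bool; true; false; T)
open import Data.Bool.Properties using (T-≡)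
open import Data.Empty using (⊥; ⊥-elim)
open import Data.Fin using (Fin; zero; suc; toℕ) renaming (_<_ to _<ᶠ_)
open import Data.Fin.Subset using (_∈_; _∩_; _∪_; Empty) renaming (⊥ to ∅; ⊤ to full)
open import Data.Fin.Subset.Properties
  using (drop-there; drop-not-there; drop-∷-⊆; s⊆s; Empty-unique; ∉⊥; ∣⊥∣≡0; ∣p∣≤n; ∣p∣≡n⇒p≡⊤;
         x∈⁅x⁆; x∈p∩q⁻; x∈p∪q⁺; p─q⊆p; p─⊤≡⊥; ∩-comm; ∪-comm; ∩-idem; ∪-idem)
open import Data.Nat using (zero; suc; _<_; _∸_; _≤ᵇ_; _≡ᵇ_; z≤n; s≤s; s≤s⁻¹; z<s)
open import Data.Nat.Properties
  using (≡ᵇ⇒≡; ≡⇒≡ᵇ; suc-injective; n∸n≡0; +-∸-assoc; +-suc; +-comm; ≤-trans; <-≤-trans; n≤1+n; <⇒≱;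
         m<m+n; m≤n+m; m≤n⇒m<n∨m≡n; module ≤-Reasoning)
open import Data.Product using (Σ-syntax; ∃-syntax; _,_; proj₁; proj₂; map₂; swap)
open import Data.Product.Function.NonDependent.Propositional using (_×-⇔_)
open import Data.Sum using (_⊎_; inj₁; inj₂)
open import Data.Unit using (⊤; tt)
open import Data.Vec using (_∷_; []; tabulate; replicate; tail; here; there)
open import Data.Vec.Properties using (tabulate-cong)
open import Function using (_∘_)
open import Function.Bundles using (Equivalence; mk⇔)
open import Function.Construct.Composition using (_⇔-∘_)
open import Function.Construct.Symmetry using (⇔-sym)
open import Relation.Nullary using (¬_)
open import Relation.Binary.PropositionalEquality
  using (_≡_; refl; sym; trans; cong; subst; subst₂; module ≡-Reasoning)

open Equivalence using (to; from)

private
  variable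
    n f g : ℕ
    b : Bool
    p q X Y A B : Subset n

Saturated : ℕ → Family n → Family n → Set
Saturated f 𝓕 𝓖 = ∀ X → ∣ X ∣ ≡ f → (∀ G → 𝓖 G → Nonempty (X ∩ G)) → 𝓕 X

Nonempty-∩-comm : Nonempty (p ∩ q) → Nonempty (q ∩ p)
Nonempty-∩-comm {p = p} {q = q} = subst Nonempty (∩-comm p q)

CrossIntersecting-sym : {𝓕 𝓖 : Family n} → CrossIntersecting 𝓕 𝓖 → CrossIntersecting 𝓖 𝓕
CrossIntersecting-sym ci G F G∈ F∈ = Nonempty-∩-comm (ci F G F∈ G∈)

MaximalPair-sym : {𝓕 𝓖 : Family n} → MaximalPair f g 𝓕 𝓖 → MaximalPair g f 𝓖 𝓕
MaximalPair-sym (ci , maximal) =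
  CrossIntersecting-sym ci ,
  λ 𝓖′ 𝓕′ u𝓖′ u𝓕′ ci′ 𝓖⊑ 𝓕⊑ → swap (maximal 𝓕′ 𝓖′ u𝓕′ u𝓖′ (CrossIntersecting-sym ci′) 𝓕⊑ 𝓖⊑)

-- Adding X to 𝓕 keeps the pair uniform and cross-intersecting, so maximality puts X in 𝓕.
MaximalPair⇒Saturated : {𝓕 𝓖 : Family n} → Uniform f 𝓕 → Uniform g 𝓖 →
  MaximalPair f g 𝓕 𝓖 → Saturated f 𝓕 𝓖
MaximalPair⇒Saturated {n = n} {f = f} {𝓕 = 𝓕} {𝓖} u𝓕 u𝓖 (ci , maximal) X ∣X∣≡f meets =
  proj₁ (maximal 𝓕+X 𝓖 u𝓕+X u𝓖 ci+X (λ _ → inj₁) (λ _ G∈ → G∈)) X (inj₂ refl)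
  where
  𝓕+X : Family n
  𝓕+X F = 𝓕 F ⊎ F ≡ X

  u𝓕+X : Uniform f 𝓕+X
  u𝓕+X F (inj₁ F∈) = u𝓕 F F∈
  u𝓕+X F (inj₂ refl) = ∣X∣≡f

  ci+X : CrossIntersecting 𝓕+X 𝓖
  ci+X F G (inj₁ F∈) G∈ = ci F G F∈ G∈
  ci+X F G (inj₂ refl) G∈ = meets G G∈

Saturated⇒MaximalPair : {𝓕 𝓖 : Family n} → CrossIntersecting 𝓕 𝓖 →
  Saturated f 𝓕 𝓖 → Saturated g 𝓖 𝓕 → MaximalPair f g 𝓕 𝓖
Saturated⇒MaximalPair ci sat𝓕 sat𝓖 =
  ci ,
  λ 𝓕′ 𝓖′ u𝓕′ u𝓖′ ci′ 𝓕⊑ 𝓖⊑ →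
    (λ X X∈ → sat𝓕 X (u𝓕′ X X∈) λ G G∈ → ci′ X G X∈ (𝓖⊑ G G∈)) ,
    (λ Y Y∈ → sat𝓖 Y (u𝓖′ Y Y∈) λ F F∈ → Nonempty-∩-comm (ci′ F Y (𝓕⊑ F F∈) Y∈))

MaximalPair⇔Saturated : {𝓕 𝓖 : Family n} → Uniform f 𝓕 → Uniform g 𝓖 →
  MaximalPair f g 𝓕 𝓖 ⇔ (CrossIntersecting 𝓕 𝓖 × Saturated f 𝓕 𝓖 × Saturated g 𝓖 𝓕)
MaximalPair⇔Saturated u𝓕 u𝓖 = mk⇔
  (λ max → proj₁ max , MaximalPair⇒Saturated u𝓕 u𝓖 max ,
           MaximalPair⇒Saturated u𝓖 u𝓕 (MaximalPair-sym max))
  (λ (ci , sat𝓕 , sat𝓖) → Saturated⇒MaximalPair ci sat𝓕 sat𝓖)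

MaximalPair-resp : {𝓕 𝓕′ 𝓖 𝓖′ : Family n} → (∀ X → 𝓕 X ⇔ 𝓕′ X) → (∀ X → 𝓖 X ⇔ 𝓖′ X) →
  MaximalPair f g 𝓕 𝓖 → MaximalPair f g 𝓕′ 𝓖′
MaximalPair-resp 𝓕≐ 𝓖≐ (ci , maximal) =
  (λ F G F∈ G∈ → ci F G (from (𝓕≐ F) F∈) (from (𝓖≐ G) G∈)) ,
  λ 𝓕″ 𝓖″ u𝓕″ u𝓖″ ci″ 𝓕′⊑ 𝓖′⊑ →
    let 𝓕″⊑ , 𝓖″⊑ = maximal 𝓕″ 𝓖″ u𝓕″ u𝓖″ ci″ (λ X → 𝓕′⊑ X ∘ to (𝓕≐ X)) (λ X → 𝓖′⊑ X ∘ to (𝓖≐ X))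
    in (λ X → to (𝓕≐ X) ∘ 𝓕″⊑ X) , (λ X → to (𝓖≐ X) ∘ 𝓖″⊑ X)

-- The lexicographic order, computed from the first point

Lex : Subset n → Subset n → Set
Lex [] [] = ⊤
Lex (true ∷ F) (true ∷ A) = Lex F A
Lex (false ∷ F) (false ∷ A) = Lex F A
Lex (true ∷ F) (false ∷ A) = ⊤
Lex (false ∷ F) (true ∷ A) = ⊥

Lex-refl : (A : Subset n) → Lex A A
Lex-refl [] = tt
Lex-refl (true ∷ A) = Lex-refl A
Lex-refl (false ∷ A) = Lex-refl A

≺-∷⁺ : ∀ {n b} {X Y : Subset n} → X ≺ Y → (b ∷ X) ≺ (b ∷ Y)
≺-∷⁺ (inj₁ Y⊆X) = inj₁ (s⊆s Y⊆X)
≺-∷⁺ {b = b} {X} {Y} (inj₂ (i , i∈X , i∉Y , below)) =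
  inj₂ (suc i , there i∈X , i∉Y ∘ drop-there , below′)
  where
  below′ : ∀ j → j <ᶠ suc i → j ∈ (b ∷ Y) → j ∈ (b ∷ X)
  below′ zero _ here = here
  below′ (suc j) (s≤s j<i) j∈Y = there (below j j<i (drop-there j∈Y))

≺-∷⁻ : (b ∷ X) ≺ (b ∷ Y) → X ≺ Y
≺-∷⁻ (inj₁ Y⊆X) = inj₁ (drop-∷-⊆ Y⊆X)
≺-∷⁻ {b = true} (inj₂ (zero , _ , 0∉Y , _)) = ⊥-elim (0∉Y here)
≺-∷⁻ {b = false} (inj₂ (zero , () , _))
≺-∷⁻ (inj₂ (suc i , i∈X , i∉Y , below)) =
  inj₂ (i , drop-there i∈X , drop-not-there i∉Y ,
        λ j j<i j∈Y → drop-there (below (suc j) (s≤s j<i) (there j∈Y)))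

¬false∷≺true∷ : ¬ (false ∷ X) ≺ (true ∷ Y)
¬false∷≺true∷ (inj₁ Y⊆X) with Y⊆X here
... | ()
¬false∷≺true∷ (inj₂ (zero , () , _))
¬false∷≺true∷ (inj₂ (suc i , _ , _ , below)) with below zero (s≤s z≤n) here
... | ()

≺⇒Lex : (F A : Subset n) → F ≺ A → Lex F A
≺⇒Lex [] [] _ = tt
≺⇒Lex (true ∷ F) (true ∷ A) F≺A = ≺⇒Lex F A (≺-∷⁻ F≺A)
≺⇒Lex (false ∷ F) (false ∷ A) F≺A = ≺⇒Lex F A (≺-∷⁻ F≺A)
≺⇒Lex (true ∷ F) (false ∷ A) _ = tt
≺⇒Lex (false ∷ F) (true ∷ A) F≺A = ¬false∷≺true∷ F≺A

Lex⇒≺ : (F A : Subset n) → Lex F A → F ≺ A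
Lex⇒≺ [] [] _ = inj₁ (λ ())
Lex⇒≺ (true ∷ F) (true ∷ A) F≤A = ≺-∷⁺ (Lex⇒≺ F A F≤A)
Lex⇒≺ (false ∷ F) (false ∷ A) F≤A = ≺-∷⁺ (Lex⇒≺ F A F≤A)
Lex⇒≺ (true ∷ F) (false ∷ A) _ = inj₂ (zero , here , (λ ()) , λ _ ())

LexSeg : Subset n → Family n
LexSeg A F = ∣ F ∣ ≡ ∣ A ∣ × Lex F A

𝓛⇔LexSeg : (A F : Subset n) → 𝓛 A ∣ A ∣ F ⇔ LexSeg A F
𝓛⇔LexSeg A F = mk⇔ (map₂ (≺⇒Lex F A)) (map₂ (Lex⇒≺ F A))

LexMaximal : Subset n → Subset n → Set
LexMaximal A B =
  CrossIntersecting (LexSeg A) (LexSeg B) ×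
  (Saturated ∣ A ∣ (LexSeg A) (LexSeg B)) × (Saturated ∣ B ∣ (LexSeg B) (LexSeg A))

Maximal⇔LexMaximal : (A B : Subset n) → Maximal A B ⇔ LexMaximal A B
Maximal⇔LexMaximal A B =
  MaximalPair⇔Saturated (λ _ → proj₁) (λ _ → proj₁) ⇔-∘
  mk⇔ (MaximalPair-resp (𝓛⇔LexSeg A) (𝓛⇔LexSeg B))
      (MaximalPair-resp (⇔-sym ∘ 𝓛⇔LexSeg A) (⇔-sym ∘ 𝓛⇔LexSeg B))

LexLast : Subset n → Set
LexLast A = ∀ Z → ∣ Z ∣ ≡ ∣ A ∣ → Lex Z A

drop-∷-Nonempty : Nonempty (false ∷ p) → Nonempty p
drop-∷-Nonempty (zero , ())
drop-∷-Nonempty (suc i , there i∈p) = i , i∈p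

there-Nonempty : Nonempty p → Nonempty (b ∷ p)
there-Nonempty (i , i∈p) = suc i , there i∈p

Nonempty⇒∣∣≡suc : Nonempty p → ∃[ k ] ∣ p ∣ ≡ suc k
Nonempty⇒∣∣≡suc {p = true ∷ p} _ = ∣ p ∣ , refl
Nonempty⇒∣∣≡suc {p = false ∷ p} ne = Nonempty⇒∣∣≡suc (drop-∷-Nonempty ne)

subset-of-size : ∀ {k} → k ≤ n → Σ[ Y ∈ Subset n ] ∣ Y ∣ ≡ k
subset-of-size {n} {zero} _ = ∅ , ∣⊥∣≡0 n
subset-of-size {suc n} {suc k} (s≤s k≤n) =
  let Y , ∣Y∣≡k = subset-of-size k≤n in true ∷ Y , cong suc ∣Y∣≡k

disjoint-of-size : (Z : Subset n) (k : ℕ) → ∣ Z ∣ + k ≤ n →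
  Σ[ Y ∈ Subset n ] ∣ Y ∣ ≡ k × Empty (Z ∩ Y)
disjoint-of-size {n} Z zero _ = ∅ , ∣⊥∣≡0 n , λ (i , i∈Z∩∅) → ∉⊥ (proj₂ (x∈p∩q⁻ Z ∅ i∈Z∩∅))
disjoint-of-size [] (suc k) ()
disjoint-of-size (true ∷ Z) (suc k) le =
  let Y , ∣Y∣≡ , Z∩Y=∅ = disjoint-of-size Z (suc k) (s≤s⁻¹ le)
  in false ∷ Y , ∣Y∣≡ , Z∩Y=∅ ∘ drop-∷-Nonempty
disjoint-of-size {suc n} (false ∷ Z) (suc k) le =
  let Y , ∣Y∣≡ , Z∩Y=∅ = disjoint-of-size Z k (s≤s⁻¹ (subst (_≤ suc n) (+-suc ∣ Z ∣ k) le))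
  in true ∷ Y , cong suc ∣Y∣≡ , Z∩Y=∅ ∘ drop-∷-Nonempty

LexMaximal-sym : LexMaximal A B → LexMaximal B A
LexMaximal-sym (ci , satA , satB) = CrossIntersecting-sym ci , satB , satA

LexMaximal⇒Nonempty : LexMaximal A B → Nonempty B
LexMaximal⇒Nonempty {A = A} {B = B} (ci , _) =
  let i , i∈A∩B = ci A B (refl , Lex-refl A) (refl , Lex-refl B) in i , proj₂ (x∈p∩q⁻ A B i∈A∩B)

-- true ∷ Y lies in 𝓛(false ∷ B) for every Y of size ∣ B ∣ - 1, and one of them avoids X.
¬meets-false∷ : ∀ {n} {B X : Subset n} → Nonempty B → ∣ X ∣ + ∣ B ∣ ≤ suc n →
  ¬ (∀ G → LexSeg (false ∷ B) G → Nonempty ((false ∷ X) ∩ G))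
¬meets-false∷ {n} {B} {X} ne le meets =
  let k , ∣B∣≡1+k = Nonempty⇒∣∣≡suc ne
      Y , ∣Y∣≡k , X∩Y=∅ = disjoint-of-size X k (bound k ∣B∣≡1+k)
  in X∩Y=∅ (drop-∷-Nonempty (meets (true ∷ Y) (trans (cong suc ∣Y∣≡k) (sym ∣B∣≡1+k) , tt)))
  where
  bound : ∀ k → ∣ B ∣ ≡ suc k → ∣ X ∣ + k ≤ n
  bound k ∣B∣≡1+k =
    s≤s⁻¹ (subst (_≤ suc n) (trans (cong (∣ X ∣ +_) ∣B∣≡1+k) (+-suc ∣ X ∣ k)) le)

¬LexMaximal-false∷-false∷ : ∀ {n} {A B : Subset n} → ∣ A ∣ + ∣ B ∣ ≤ suc n →
  ¬ LexMaximal (false ∷ A) (false ∷ B)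
¬LexMaximal-false∷-false∷ {A = A} le max@(ci , _) =
  ¬meets-false∷ (drop-∷-Nonempty (LexMaximal⇒Nonempty max)) le
    (λ G G∈ → ci (false ∷ A) G (refl , Lex-refl A) G∈)

LexMaximal-true∷-false∷⁻ : ∀ {n} {A B : Subset n} →
  LexMaximal (true ∷ A) (false ∷ B) → LexMaximal A B
LexMaximal-true∷-false∷⁻ {A = A} {B} (ci , satA , satB) = ci′ , satA′ , satB′
  where
  ci′ : CrossIntersecting (LexSeg A) (LexSeg B)
  ci′ F G (∣F∣≡ , F≤A) G∈ = drop-∷-Nonempty (ci (true ∷ F) (false ∷ G) (cong suc ∣F∣≡ , F≤A) G∈)

  satA′ : Saturated ∣ A ∣ (LexSeg A) (LexSeg B)
  satA′ X ∣X∣≡ meets = ∣X∣≡ , proj₂ (satA (true ∷ X) (cong suc ∣X∣≡) meets′)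
    where
    meets′ : ∀ G → LexSeg (false ∷ B) G → Nonempty ((true ∷ X) ∩ G)
    meets′ (true ∷ G) _ = zero , here
    meets′ (false ∷ G) G∈ = there-Nonempty (meets G G∈)

  satB′ : Saturated ∣ B ∣ (LexSeg B) (LexSeg A)
  satB′ Y ∣Y∣≡ meets = satB (false ∷ Y) ∣Y∣≡ meets′
    where
    meets′ : ∀ F → LexSeg (true ∷ A) F → Nonempty ((false ∷ Y) ∩ F)
    meets′ (true ∷ F) (∣F∣≡ , F≤A) = there-Nonempty (meets F (suc-injective ∣F∣≡ , F≤A))
    meets′ (false ∷ F) (_ , ())

LexMaximal-true∷-false∷⁺ : ∀ {n} {A B : Subset n} → suc ∣ A ∣ + ∣ B ∣ ≤ suc n →
  LexMaximal A B → LexMaximal (true ∷ A) (false ∷ B)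
LexMaximal-true∷-false∷⁺ {n} {A} {B} le max@(ci , satA , satB) = ci′ , satA′ , satB′
  where
  ci′ : CrossIntersecting (LexSeg (true ∷ A)) (LexSeg (false ∷ B))
  ci′ (true ∷ F) (true ∷ G) _ _ = zero , here
  ci′ (true ∷ F) (false ∷ G) (∣F∣≡ , F≤A) G∈ =
    there-Nonempty (ci F G (suc-injective ∣F∣≡ , F≤A) G∈)
  ci′ (false ∷ F) G (_ , ()) _

  satA′ : Saturated (suc ∣ A ∣) (LexSeg (true ∷ A)) (LexSeg (false ∷ B))
  satA′ (true ∷ X) ∣X∣≡ meets =
    ∣X∣≡ , proj₂ (satA X (suc-injective ∣X∣≡) λ G G∈ → drop-∷-Nonempty (meets (false ∷ G) G∈))
  satA′ (false ∷ X) ∣X∣≡ meets =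
    ⊥-elim (¬meets-false∷ (LexMaximal⇒Nonempty max)
              (subst (λ m → m + ∣ B ∣ ≤ suc n) (sym ∣X∣≡) le) meets)

  satB′ : Saturated ∣ B ∣ (LexSeg (false ∷ B)) (LexSeg (true ∷ A))
  satB′ (true ∷ Y) ∣Y∣≡ _ = ∣Y∣≡ , tt
  satB′ (false ∷ Y) ∣Y∣≡ meets =
    satB Y ∣Y∣≡ λ F (∣F∣≡ , F≤A) → drop-∷-Nonempty (meets (true ∷ F) (cong suc ∣F∣≡ , F≤A))

Saturated-true∷⇒LexLast : Saturated (suc ∣ A ∣) (LexSeg (true ∷ A)) (LexSeg (true ∷ B)) →
  LexLast A
Saturated-true∷⇒LexLast sat Z ∣Z∣≡ = proj₂ (sat (true ∷ Z) (cong suc ∣Z∣≡) meets)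
  where
  meets : ∀ G → LexSeg (true ∷ _) G → Nonempty ((true ∷ Z) ∩ G)
  meets (true ∷ G) _ = zero , here
  meets (false ∷ G) (_ , ())

LexLast⇒Saturated-true∷ : ∀ {n} {A B : Subset n} → suc ∣ A ∣ + suc ∣ B ∣ ≤ suc n →
  LexLast A → LexLast B → Saturated (suc ∣ A ∣) (LexSeg (true ∷ A)) (LexSeg (true ∷ B))
LexLast⇒Saturated-true∷ le lastA lastB (true ∷ X) ∣X∣≡ _ = ∣X∣≡ , lastA X (suc-injective ∣X∣≡)
LexLast⇒Saturated-true∷ {n} {A} {B} le lastA lastB (false ∷ X) ∣X∣≡ meets =
  let Y , ∣Y∣≡ , X∩Y=∅ = disjoint-of-size X ∣ B ∣ bound
  in ⊥-elim (X∩Y=∅ (drop-∷-Nonempty (meets (true ∷ Y) (cong suc ∣Y∣≡ , lastB Y ∣Y∣≡))))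
  where
  open ≤-Reasoning
  bound : ∣ X ∣ + ∣ B ∣ ≤ n
  bound = begin
    ∣ X ∣ + ∣ B ∣       ≡⟨ cong (_+ ∣ B ∣) ∣X∣≡ ⟩
    suc ∣ A ∣ + ∣ B ∣   ≡⟨ sym (+-suc ∣ A ∣ ∣ B ∣) ⟩
    ∣ A ∣ + suc ∣ B ∣   ≤⟨ s≤s⁻¹ le ⟩
    n                   ∎

CrossIntersecting-true∷ : CrossIntersecting (LexSeg (true ∷ A)) (LexSeg (true ∷ B))
CrossIntersecting-true∷ (true ∷ F) (true ∷ G) _ _ = zero , here
CrossIntersecting-true∷ (false ∷ F) _ (_ , ()) _
CrossIntersecting-true∷ (true ∷ F) (false ∷ G) _ (_ , ())

LexMaximal-true∷-true∷ : ∀ {n} {A B : Subset n} → suc ∣ A ∣ + suc ∣ B ∣ ≤ suc n →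
  LexMaximal (true ∷ A) (true ∷ B) ⇔ (LexLast A × LexLast B)
LexMaximal-true∷-true∷ {n} {A} {B} le = mk⇔
  (λ (_ , satA , satB) → Saturated-true∷⇒LexLast satA , Saturated-true∷⇒LexLast satB)
  (λ (lastA , lastB) →
    CrossIntersecting-true∷ ,
    LexLast⇒Saturated-true∷ le lastA lastB ,
    LexLast⇒Saturated-true∷ (subst (_≤ suc n) (+-comm (suc ∣ A ∣) (suc ∣ B ∣)) le) lastB lastA)

-- Terminal segments

trim : Subset n → Subset n
trim A = A ─ (A ᵗ)

tabulate-const : ∀ n (x : Bool) → tabulate {n = n} (λ _ → x) ≡ replicate n x
tabulate-const zero x = refl
tabulate-const (suc n) x = cong (x ∷_) (tabulate-const n x)

suc≤ᵇsuc : ∀ m k → (suc m ≤ᵇ suc k) ≡ (m ≤ᵇ k)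
suc≤ᵇsuc zero k = refl
suc≤ᵇsuc (suc m) k = refl

ℓ≤∣∣ : (v : Subset n) → ℓ v ≤ ∣ v ∣
ℓ≤∣∣ [] = z≤n
ℓ≤∣∣ (false ∷ v) = ℓ≤∣∣ v
ℓ≤∣∣ {suc n} (true ∷ v) with ℓ v ≡ᵇ n in eq
... | true = s≤s (subst (_≤ ∣ v ∣) (≡ᵇ⇒≡ (ℓ v) n (subst T (sym eq) tt)) (ℓ≤∣∣ v))
... | false = ≤-trans (ℓ≤∣∣ v) (n≤1+n _)

ℓ-true∷ : ∀ {n} (v : Subset n) → ∣ v ∣ < n → ℓ (true ∷ v) ≡ ℓ v
ℓ-true∷ {n} v ∣v∣<n with ℓ v ≡ᵇ n in eq
... | true = ⊥-elim (<⇒≱ ∣v∣<n (subst (_≤ ∣ v ∣) (≡ᵇ⇒≡ (ℓ v) n (subst T (sym eq) tt)) (ℓ≤∣∣ v)))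
... | false = refl

ℓ-full : ∀ n → ℓ (full {n}) ≡ n
ℓ-full zero = refl
ℓ-full (suc n) rewrite ℓ-full n | to T-≡ (≡⇒≡ᵇ n n refl) = refl

ᵗ-∷ : ∀ {n} b (v : Subset n) → ℓ (b ∷ v) ≡ ℓ v → (b ∷ v) ᵗ ≡ false ∷ (v ᵗ)
ᵗ-∷ {n} b v ℓ≡ = begin
  tabulate (λ i → (suc n ∸ ℓ (b ∷ v)) ≤ᵇ toℕ i)
    ≡⟨ cong (λ m → tabulate (λ i → (suc n ∸ m) ≤ᵇ toℕ {suc n} i)) ℓ≡ ⟩
  tabulate (λ i → (suc n ∸ ℓ v) ≤ᵇ toℕ i)
    ≡⟨ cong (λ m → tabulate (λ i → m ≤ᵇ toℕ {suc n} i)) (+-∸-assoc 1 (≤-trans (ℓ≤∣∣ v) (∣p∣≤n v))) ⟩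
  tabulate (λ i → suc (n ∸ ℓ v) ≤ᵇ toℕ i)
    ≡⟨ cong (false ∷_) (tabulate-cong (λ i → suc≤ᵇsuc (n ∸ ℓ v) (toℕ i))) ⟩
  false ∷ (v ᵗ) ∎
  where open ≡-Reasoning

trim-false∷ : (v : Subset n) → trim (false ∷ v) ≡ false ∷ trim v
trim-false∷ v = cong ((false ∷ v) ─_) (ᵗ-∷ false v refl)

trim-true∷ : ∀ {n} (v : Subset n) → ∣ v ∣ < n → trim (true ∷ v) ≡ true ∷ trim v
trim-true∷ v ∣v∣<n = cong ((true ∷ v) ─_) (ᵗ-∷ true v (ℓ-true∷ v ∣v∣<n))

trim-full : ∀ n → trim (full {n}) ≡ ∅
trim-full n = begin
  full ─ tabulate (λ i → (n ∸ ℓ (full {n})) ≤ᵇ toℕ i)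
    ≡⟨ cong (λ m → full ─ tabulate (λ i → (n ∸ m) ≤ᵇ toℕ {n} i)) (ℓ-full n) ⟩
  full ─ tabulate (λ i → (n ∸ n) ≤ᵇ toℕ i)
    ≡⟨ cong (λ m → full ─ tabulate (λ i → m ≤ᵇ toℕ {n} i)) (n∸n≡0 n) ⟩
  full ─ tabulate (λ _ → true)
    ≡⟨ cong (full ─_) (tabulate-const n true) ⟩
  full ─ full
    ≡⟨ p─⊤≡⊥ full ⟩
  ∅ ∎
  where open ≡-Reasoning

LexLast⇒trim≡∅ : (X : Subset n) → LexLast X → trim X ≡ ∅
LexLast⇒trim≡∅ [] _ = refl
LexLast⇒trim≡∅ (false ∷ X) last =
  trans (trim-false∷ X) (cong (false ∷_) (LexLast⇒trim≡∅ X (λ Z → last (false ∷ Z))))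
LexLast⇒trim≡∅ {suc n} (true ∷ X) last with m≤n⇒m<n∨m≡n (∣p∣≤n X)
... | inj₂ ∣X∣≡n = trans (cong (λ W → trim (true ∷ W)) (∣p∣≡n⇒p≡⊤ ∣X∣≡n)) (trim-full (suc n))
... | inj₁ ∣X∣<n = let Z , ∣Z∣≡ = subset-of-size ∣X∣<n in ⊥-elim (last (false ∷ Z) ∣Z∣≡)

trim≡∅⇒LexLast : (X : Subset n) → trim X ≡ ∅ → LexLast X
trim≡∅⇒LexLast [] _ [] _ = tt
trim≡∅⇒LexLast (false ∷ X) _ (true ∷ Z) _ = tt
trim≡∅⇒LexLast (false ∷ X) trim≡∅ (false ∷ Z) ∣Z∣≡ =
  trim≡∅⇒LexLast X (cong tail (trans (sym (trim-false∷ X)) trim≡∅)) Z ∣Z∣≡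
trim≡∅⇒LexLast {suc n} (true ∷ X) trim≡∅ Z ∣Z∣≡ with m≤n⇒m<n∨m≡n (∣p∣≤n X)
... | inj₂ ∣X∣≡n =
  subst₂ (λ Z′ X′ → Lex Z′ (true ∷ X′)) (sym (∣p∣≡n⇒p≡⊤ {p = Z} (trans ∣Z∣≡ (cong suc ∣X∣≡n))))
    (sym (∣p∣≡n⇒p≡⊤ {p = X} ∣X∣≡n)) (Lex-refl (full {suc n}))
... | inj₁ ∣X∣<n with trans (sym (trim-true∷ X ∣X∣<n)) trim≡∅
...   | ()

LexLast⇔trim≡∅ : (X : Subset n) → LexLast X ⇔ (trim X ≡ ∅)
LexLast⇔trim≡∅ X = mk⇔ (LexLast⇒trim≡∅ X) (trim≡∅⇒LexLast X)

upto-zero : ∀ {n} → upto {suc n} zero ≡ true ∷ ∅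
upto-zero {n} = cong (true ∷_) (tabulate-const n false)

upto-suc : ∀ {n} (q : Fin n) → upto (suc q) ≡ true ∷ upto q
upto-suc q = cong (true ∷_) (tabulate-cong (λ j → suc≤ᵇsuc (toℕ j) (toℕ q)))

∪≡∅ : (p q : Subset n) → p ∪ q ≡ ∅ → p ≡ ∅ × q ≡ ∅
∪≡∅ p q p∪q≡∅ =
  Empty-unique (λ (i , i∈p) → ∉⊥ (subst (i ∈_) p∪q≡∅ (x∈p∪q⁺ (inj₁ i∈p)))) ,
  Empty-unique (λ (i , i∈q) → ∉⊥ (subst (i ∈_) p∪q≡∅ (x∈p∪q⁺ (inj₂ i∈q))))

Partner-sym : Partner X Y → Partner Y X
Partner-sym {X = X} {Y = Y} (q , X∩Y≡ , X∪Y≡) =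
  q , trans (∩-comm Y X) X∩Y≡ , trans (∪-comm Y X) X∪Y≡

Partner⇒Nonempty : Partner X Y → Nonempty Y
Partner⇒Nonempty {X = X} {Y = Y} (q , X∩Y≡ , _) =
  q , proj₂ (x∈p∩q⁻ X Y (subst (q ∈_) (sym X∩Y≡) (x∈⁅x⁆ q)))

¬Partner-false∷-false∷ : ¬ Partner (false ∷ X) (false ∷ Y)
¬Partner-false∷-false∷ (q , _ , ())

Partner-true∷-false∷ : Partner (true ∷ X) (false ∷ Y) ⇔ Partner X Y
Partner-true∷-false∷ = mk⇔
  (λ { (zero , () , _)
     ; (suc q , X∩Y≡ , X∪Y≡) → q , cong tail X∩Y≡ , cong tail (trans X∪Y≡ (upto-suc q)) })
  (λ (q , X∩Y≡ , X∪Y≡) →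
     suc q , cong (false ∷_) X∩Y≡ , trans (cong (true ∷_) X∪Y≡) (sym (upto-suc q)))

Partner-true∷-true∷ : Partner (true ∷ X) (true ∷ Y) ⇔ (X ≡ ∅ × Y ≡ ∅)
Partner-true∷-true∷ {X = X} {Y = Y} = mk⇔
  (λ { (zero , _ , X∪Y≡) → ∪≡∅ X Y (cong tail (trans X∪Y≡ upto-zero))
     ; (suc q , () , _) })
  (λ { (refl , refl) →
         zero , cong (true ∷_) (∩-idem ∅) , trans (cong (true ∷_) (∪-idem ∅)) (sym upto-zero) })

Partner-trim-true∷-false∷ : ∀ {n} {A B : Subset n} → ∣ A ∣ + ∣ B ∣ ≤ n →
  Partner (trim (true ∷ A)) (trim (false ∷ B)) ⇔ Partner (trim A) (trim B)
Partner-trim-true∷-false∷ {n} {A} {B} le = mk⇔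
  (λ par → to (unfold (nonempty (drop-∷-Nonempty (Partner⇒Nonempty (trimmed par))))) par)
  (λ par → from (unfold (nonempty (Partner⇒Nonempty par))) par)
  where
  trimmed : Partner (trim (true ∷ A)) (trim (false ∷ B)) → Partner (trim (true ∷ A)) (false ∷ trim B)
  trimmed = subst (Partner _) (trim-false∷ B)

  nonempty : Nonempty (trim B) → Nonempty B
  nonempty = map₂ (p─q⊆p B (B ᵗ))

  ∣A∣<n : Nonempty B → ∣ A ∣ < n
  ∣A∣<n ne = let k , ∣B∣≡1+k = Nonempty⇒∣∣≡suc ne
             in <-≤-trans (m<m+n ∣ A ∣ (subst (0 <_) (sym ∣B∣≡1+k) z<s)) le

  unfold : Nonempty B → Partner (trim (true ∷ A)) (trim (false ∷ B)) ⇔ Partner (trim A) (trim B)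
  unfold ne = subst₂ (λ X Y → Partner X Y ⇔ Partner (trim A) (trim B))
    (sym (trim-true∷ A (∣A∣<n ne))) (sym (trim-false∷ B)) Partner-true∷-false∷

LexMaximal⇔Partner-true∷-true∷ : ∀ {n} {A B : Subset n} → suc ∣ A ∣ + suc ∣ B ∣ ≤ suc n →
  LexMaximal (true ∷ A) (true ∷ B) ⇔ Partner (trim (true ∷ A)) (trim (true ∷ B))
LexMaximal⇔Partner-true∷-true∷ {n} {A} {B} le =
  subst₂ (λ X Y → LexMaximal (true ∷ A) (true ∷ B) ⇔ Partner X Y)
    (sym (trim-true∷ A ∣A∣<n)) (sym (trim-true∷ B ∣B∣<n))
    (⇔-sym Partner-true∷-true∷ ⇔-∘
      ((LexLast⇔trim≡∅ A ×-⇔ LexLast⇔trim≡∅ B) ⇔-∘ LexMaximal-true∷-true∷ le))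
  where
  ∣A∣<n : ∣ A ∣ < n
  ∣A∣<n = <-≤-trans (m<m+n ∣ A ∣ z<s) (s≤s⁻¹ le)

  ∣B∣<n : ∣ B ∣ < n
  ∣B∣<n = ≤-trans (m≤n+m (suc ∣ B ∣) ∣ A ∣) (s≤s⁻¹ le)

LexMaximal⇔Partner-true∷-false∷ : ∀ {n} {A B : Subset n} → suc ∣ A ∣ + ∣ B ∣ ≤ suc n →
  LexMaximal A B ⇔ Partner (trim A) (trim B) →
  LexMaximal (true ∷ A) (false ∷ B) ⇔ Partner (trim (true ∷ A)) (trim (false ∷ B))
LexMaximal⇔Partner-true∷-false∷ le ih =
  ⇔-sym (Partner-trim-true∷-false∷ (s≤s⁻¹ le)) ⇔-∘
    (ih ⇔-∘ mk⇔ LexMaximal-true∷-false∷⁻ (LexMaximal-true∷-false∷⁺ le))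

LexMaximal⇔Partner-sym : LexMaximal A B ⇔ Partner (trim A) (trim B) →
  LexMaximal B A ⇔ Partner (trim B) (trim A)
LexMaximal⇔Partner-sym e =
  mk⇔ (Partner-sym ∘ to e ∘ LexMaximal-sym) (LexMaximal-sym ∘ from e ∘ Partner-sym)

LexMaximal⇔Partner : ∀ {n} (A B : Subset n) → ∣ A ∣ + ∣ B ∣ ≤ n →
  LexMaximal A B ⇔ Partner (trim A) (trim B)
LexMaximal⇔Partner [] [] _ = mk⇔ ((λ { (() , _) }) ∘ LexMaximal⇒Nonempty) (λ { (() , _) })
LexMaximal⇔Partner (true ∷ A) (true ∷ B) le = LexMaximal⇔Partner-true∷-true∷ le
LexMaximal⇔Partner (false ∷ A) (false ∷ B) le = mk⇔
  (⊥-elim ∘ ¬LexMaximal-false∷-false∷ le)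
  (⊥-elim ∘ ¬Partner-false∷-false∷ ∘ subst₂ Partner (trim-false∷ A) (trim-false∷ B))
LexMaximal⇔Partner (true ∷ A) (false ∷ B) le =
  LexMaximal⇔Partner-true∷-false∷ le (LexMaximal⇔Partner A B (s≤s⁻¹ le))
LexMaximal⇔Partner {suc n} (false ∷ A) (true ∷ B) le =
  LexMaximal⇔Partner-sym (LexMaximal⇔Partner-true∷-false∷ le′ (LexMaximal⇔Partner B A (s≤s⁻¹ le′)))
  where
  le′ : suc ∣ B ∣ + ∣ A ∣ ≤ suc n
  le′ = subst (_≤ suc n) (+-comm ∣ A ∣ (suc ∣ B ∣)) le

fact2p8 : ∀ (n : ℕ) (A B : Subset n) → Nonempty A → Nonempty B → ∣ A ∣ + ∣ B ∣ ≤ n →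
    Maximal A B ⇔ Partner (A ─ (A ᵗ)) (B ─ (B ᵗ))
fact2p8 n A B _ _ le = LexMaximal⇔Partner A B le ⇔-∘ Maximal⇔LexMaximal A B
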